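{- Let $q=p^{\alpha}$ with $p$ prime, list the elements of $GF(q)$ as $a_0=0,a_1,\dots,a_{q-1}$, let $t$ be an integer with $1\le t<\frac{q-1}{2}$, and let $A$ be the $q\times q$ matrix over $GF(q)$ with entries $a_{ij}=a_j^t-a_i^t$. Let $r\in GF(q)$ be nonzero and set $W=A+rI$. For a plaintext column vector $M\in GF(q)^q$ let the ciphertext be $C=WM$. Let $l\in GF(q)$ be the solution of $r^2x=1$. Then the decrypted message $D=lW^TC$ is uniquely determined and $D=M$ (all arithmetic in $GF(q)$; for $\alpha=1$ this is arithmetic modulo $p$).
   Context: This is the decryption step of an encryption scheme: the key matrix $W=A+rI$ satisfies $WW^T=r^2I$ over $GF(q)$, a message is encoded as a vector $M$ of field elements, encrypted as $C=WM$, and decrypted as $lW^TC$. -}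

module Defs where

open import Level using (Level; _⊔_) renaming (suc to lsuc)
open import Algebra.Bundles using (CommutativeRing)
open import Data.Nat using (ℕ; zero; suc)
open import Data.Fin using (Fin; zero; suc)
open import Data.Product using (∃; Σ; _×_; _,_)
open import Relation.Nullary using (¬_)
open import Relation.Binary.PropositionalEquality using (_≡_)

record Field (c ℓ : Level) : Set (lsuc (c ⊔ ℓ)) where
  field
    commutativeRing : CommutativeRing c ℓ
  open CommutativeRing commutativeRing public
  field
    1≉0     : ¬ (1# ≈ 0#)
    inverse : ∀ x → ¬ (x ≈ 0#) → ∃ λ y → x * y ≈ 1#

module FieldOps {c ℓ : Level} (F : Field c ℓ) where
  open Field F hiding (zero)

  infixr 8 _^_
  _^_ : Carrier → ℕ → Carrier
  x ^ zero  = 1#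
  x ^ suc n = x * (x ^ n)

  Σ[_] : ∀ n → (Fin n → Carrier) → Carrier
  Σ[ zero  ] f = 0#
  Σ[ suc n ] f = f zero + Σ[ n ] (λ i → f (suc i))

  Mat : ℕ → Set c
  Mat n = Fin n → Fin n → Carrier

  Vect : ℕ → Set c
  Vect n = Fin n → Carrier

  I : ∀ {n} → Mat n
  I zero    zero    = 1#
  I zero    (suc j) = 0#
  I (suc i) zero    = 0#
  I (suc i) (suc j) = I i j

  _ᵀ : ∀ {n} → Mat n → Mat n
  (X ᵀ) i j = X j i

  _·_ : ∀ {n} → Carrier → Vect n → Vect n
  (s · v) i = s * v i

  _⊛_ : ∀ {n} → Mat n → Vect n → Vect n
  (X ⊛ v) i = Σ[ _ ] (λ j → X i j * v j)

  Amat : ∀ {q} → (Fin q → Carrier) → ℕ → Mat q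
  Amat a t i j = (a j ^ t) - (a i ^ t)

  Wmat : ∀ {q} → (Fin q → Carrier) → ℕ → Carrier → Mat q
  Wmat a t r i j = Amat a t i j + (r * I i j)

module Submission where

-- Write u_k = a_k^t, so that A has entries u_j - u_i.  For any vector v put
-- S v = Σ_k v_k and P v = Σ_k u_k v_k; then
--     (W v)_j   = (P v - u_j S v) + r v_j,
--     (Wᵀ v)_i  = (u_i S v - P v) + r v_i.
-- If  Σ 1 = 0,  Σ u = 0  and  Σ u² = 0,  these formulas give S (W v) = r S v
-- and P (W v) = r P v, whence Wᵀ (W v) = r² v, and l Wᵀ (W M) = M for the
-- (unique) inverse l of r².
--
-- The three vanishing sums are instances of the classical fact that the
-- power sums Σ_{x ∈ GF(q)} x^m vanish for 0 ≤ m < q - 1: for m = 0 this is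
-- q·1 = 0 (translate by 1); for m ≥ 1, if the sum were nonzero then scaling
-- by c ≠ 0 would force c^m = 1, so all q - 1 ≥ m + 1 nonzero elements would
-- be roots of x^m - 1, while a polynomial with m + 1 coefficients and m + 1
-- distinct roots vanishes identically.
--
-- Only the finiteness of the field enters.

open import Defs
open import Level using (Level)
open import Data.Nat as ℕ using (ℕ)
open import Data.Nat.Primality using (Prime)
import Data.Nat.Properties as ℕP
open import Data.Fin as Fin using (Fin; toℕ; zero; suc; inject≤)
import Data.Fin.Properties as FinP
open import Data.Fin.Permutation using (permutation)
open import Data.List using (List; []; _∷_; length)
open import Data.Product using (∃; _×_; _,_; proj₁; proj₂)
open import Data.Empty using (⊥-elim)
open import Relation.Nullary using (¬_; Dec; yes; no)
open import Relation.Binary.PropositionalEquality as P using (_≡_)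
import Algebra.Properties.Ring as RingProperties
import Algebra.Properties.AbelianGroup as AbelianGroupProperties
import Algebra.Properties.CommutativeSemigroup as CommutativeSemigroupProperties
import Algebra.Properties.Semiring.Sum as SemiringSum
import Algebra.Properties.Semiring.Exp as SemiringExp
import Algebra.Properties.CommutativeSemiring.Exp as CommutativeSemiringExp
import Relation.Binary.Reasoning.Setoid as SetoidReasoning

module FieldTheory {c ℓ : Level} (F : Field c ℓ) where
  open Field F hiding (zero)
  open FieldOps F using (Σ[_]; _⊛_; I; _ᵀ) renaming (_^_ to _^ᶠ_)
  open RingProperties ring using (-1*x≈-x; x[y-z]≈xy-xz; [y-z]x≈yx-zx)
  module +G = AbelianGroupProperties +-abelianGroup
  module *S = CommutativeSemigroupProperties *-commutativeSemigroup
  open SemiringSum semiring using (sum; sum-cong-≋; ∑-distrib-+; *-distribˡ-sum; *-distribʳ-sum; ∑-permute)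
  open SemiringExp semiring using (_^_; ^-congˡ)
  open CommutativeSemiringExp commutativeSemiring using (^-distrib-*)
  open SetoidReasoning setoid

  inverse-cancel : ∀ {x y} → x * y ≈ 1# → ∀ z → y * (x * z) ≈ z
  inverse-cancel {x} {y} xy≈1 z = begin
    y * (x * z)  ≈⟨ sym (*-assoc y x z) ⟩
    (y * x) * z  ≈⟨ *-congʳ (trans (*-comm y x) xy≈1) ⟩
    1# * z       ≈⟨ *-identityˡ z ⟩
    z            ∎

  nonzero-cancel : ∀ {x y} → ¬ (x ≈ 0#) → x * y ≈ 0# → y ≈ 0#
  nonzero-cancel {x} {y} x≉0 xy≈0 with inverse x x≉0
  ... | x⁻¹ , xx⁻¹≈1 = begin
    y              ≈⟨ sym (inverse-cancel xx⁻¹≈1 y) ⟩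
    x⁻¹ * (x * y)  ≈⟨ *-congˡ xy≈0 ⟩
    x⁻¹ * 0#       ≈⟨ zeroʳ x⁻¹ ⟩
    0#             ∎

  inverse-unique : ∀ {x y y′} → x * y ≈ 1# → x * y′ ≈ 1# → y′ ≈ y
  inverse-unique {x} {y} {y′} xy≈1 xy′≈1 = begin
    y′            ≈⟨ sym (inverse-cancel xy≈1 y′) ⟩
    y * (x * y′)  ≈⟨ *-congˡ xy′≈1 ⟩
    y * 1#        ≈⟨ *-identityʳ y ⟩
    y             ∎

  Σ≡sum : ∀ n (f : Fin n → Carrier) → Σ[ n ] f ≡ sum f
  Σ≡sum ℕ.zero    f = P.refl
  Σ≡sum (ℕ.suc n) f = P.cong (f zero +_) (Σ≡sum n (λ i → f (suc i)))

  ⊛-sum : ∀ {n} (X : Fin n → Fin n → Carrier) v i → (X ⊛ v) i ≡ sum (λ j → X i j * v j)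
  ⊛-sum {n} X v i = Σ≡sum n (λ j → X i j * v j)

  sum-neg : ∀ {n} (f : Fin n → Carrier) → sum (λ i → - f i) ≈ - sum f
  sum-neg f = begin
    sum (λ i → - f i)      ≈⟨ sum-cong-≋ (λ i → sym (-1*x≈-x (f i))) ⟩
    sum (λ i → - 1# * f i) ≈⟨ sym (*-distribˡ-sum (- 1#) f) ⟩
    - 1# * sum f           ≈⟨ -1*x≈-x (sum f) ⟩
    - sum f                ∎

  sum-distrib-- : ∀ {n} (f g : Fin n → Carrier) → sum (λ i → f i - g i) ≈ sum f - sum g
  sum-distrib-- f g = trans (∑-distrib-+ f (λ i → - g i)) (+-congˡ (sum-neg g))

  sum-shape : ∀ {n} r (x y z : Fin n → Carrier) →
              sum (λ k → (x k - y k) + r * z k) ≈ (sum x - sum y) + r * sum z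
  sum-shape r x y z = begin
    sum (λ k → (x k - y k) + r * z k)            ≈⟨ ∑-distrib-+ (λ k → x k - y k) (λ k → r * z k) ⟩
    sum (λ k → x k - y k) + sum (λ k → r * z k)  ≈⟨ +-cong (sum-distrib-- x y) (sym (*-distribˡ-sum r z)) ⟩
    (sum x - sum y) + r * sum z                  ∎

  sum-I : ∀ {n} (i : Fin n) (f : Fin n → Carrier) → sum (λ j → I i j * f j) ≈ f i
  sum-I {ℕ.suc n} zero f = begin
    1# * f zero + sum (λ j → 0# * f (suc j))  ≈⟨ +-cong (*-identityˡ (f zero)) (sym (*-distribˡ-sum 0# (λ j → f (suc j)))) ⟩
    f zero + 0# * sum (λ j → f (suc j))       ≈⟨ +-congˡ (zeroˡ _) ⟩
    f zero + 0#                               ≈⟨ +-identityʳ (f zero) ⟩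
    f zero                                    ∎
  sum-I {ℕ.suc n} (suc i) f = begin
    0# * f zero + sum (λ j → I i j * f (suc j))  ≈⟨ +-cong (zeroˡ (f zero)) (sum-I i (λ j → f (suc j))) ⟩
    0# + f (suc i)                               ≈⟨ +-identityˡ (f (suc i)) ⟩
    f (suc i)                                    ∎

  I-symmetric : ∀ {n} (i j : Fin n) → I i j ≡ I j i
  I-symmetric zero    zero    = P.refl
  I-symmetric zero    (suc j) = P.refl
  I-symmetric (suc i) zero    = P.refl
  I-symmetric (suc i) (suc j) = I-symmetric i j

  sum-Iᵀ : ∀ {n} (i : Fin n) (f : Fin n → Carrier) → sum (λ j → I j i * f j) ≈ f i
  sum-Iᵀ i f = trans (sum-cong-≋ (λ j → reflexive (P.cong (_* f j) (I-symmetric j i)))) (sum-I i f)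

  sum-*ʳ-zero : ∀ {n} (f : Fin n → Carrier) x → sum f ≈ 0# → sum (λ i → f i * x) ≈ 0#
  sum-*ʳ-zero f x Σf≈0 = trans (sym (*-distribʳ-sum x f)) (trans (*-congʳ Σf≈0) (zeroˡ x))

  ^-agrees : ∀ x n → x ^ᶠ n ≡ x ^ n
  ^-agrees x ℕ.zero    = P.refl
  ^-agrees x (ℕ.suc n) = P.cong (x *_) (^-agrees x n)

  -- Polynomials, as coefficient lists with the constant term first.

  eval : List Carrier → Carrier → Carrier
  eval []       x = 0#
  eval (c ∷ cs) x = c + x * eval cs x

  -- Synthetic division by (x - r): the quotient has one coefficient fewer.
  divide : Carrier → List Carrier → List Carrier
  divide r []           = []
  divide r (c ∷ [])     = []
  divide r (c ∷ d ∷ ds) = eval (d ∷ ds) r ∷ divide r (d ∷ ds)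

  divide-length : ∀ r c cs → length (divide r (c ∷ cs)) ≡ length cs
  divide-length r c []       = P.refl
  divide-length r c (d ∷ ds) = P.cong ℕ.suc (divide-length r d ds)

  remainder-theorem : ∀ r p x → eval p x ≈ eval p r + (x - r) * eval (divide r p) x
  remainder-theorem r [] x = sym (trans (+-identityˡ _) (zeroʳ _))
  remainder-theorem r (c ∷ []) x = begin
    c + x * 0#                    ≈⟨ +-congˡ (trans (zeroʳ x) (sym (zeroʳ r))) ⟩
    c + r * 0#                    ≈⟨ sym (+-identityʳ _) ⟩
    (c + r * 0#) + 0#             ≈⟨ +-congˡ (sym (zeroʳ (x - r))) ⟩
    (c + r * 0#) + (x - r) * 0#   ∎
  remainder-theorem r (c ∷ d ∷ ds) x = begin
    c + x * E                                        ≈⟨ +-congˡ (*-congˡ (remainder-theorem r (d ∷ ds) x)) ⟩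
    c + x * (R + (x - r) * Q)                        ≈⟨ +-congˡ (distribˡ x R _) ⟩
    c + (x * R + x * ((x - r) * Q))                  ≈⟨ +-congˡ (+-cong split-x (*S.x∙yz≈y∙xz x (x - r) Q)) ⟩
    c + ((r * R + (x - r) * R) + (x - r) * (x * Q))  ≈⟨ +-congˡ (+-assoc _ _ _) ⟩
    c + (r * R + ((x - r) * R + (x - r) * (x * Q)))  ≈⟨ sym (+-assoc _ _ _) ⟩
    (c + r * R) + ((x - r) * R + (x - r) * (x * Q))  ≈⟨ +-congˡ (sym (distribˡ (x - r) R _)) ⟩
    (c + r * R) + (x - r) * (R + x * Q)              ∎
    where
    E = eval (d ∷ ds) x
    R = eval (d ∷ ds) r
    Q = eval (divide r (d ∷ ds)) x
    split-x : x * R ≈ r * R + (x - r) * R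
    split-x = begin
      x * R                ≈⟨ *-congʳ (sym (+G.xyx⁻¹≈y r x)) ⟩
      ((r + x) - r) * R    ≈⟨ *-congʳ (+-assoc r x (- r)) ⟩
      (r + (x - r)) * R    ≈⟨ distribʳ R r (x - r) ⟩
      r * R + (x - r) * R  ∎

  root-bound : ∀ n p → length p ≡ n → (b : Fin n → Carrier) →
               (∀ i j → b i ≈ b j → i ≡ j) → (∀ i → eval p (b i) ≈ 0#) →
               ∀ x → eval p x ≈ 0#
  root-bound ℕ.zero    []       _   b b-inj roots x = refl
  root-bound (ℕ.suc n) (c ∷ cs) len b b-inj roots x = begin
    eval (c ∷ cs) x                         ≈⟨ remainder-theorem b₀ (c ∷ cs) x ⟩
    eval (c ∷ cs) b₀ + (x - b₀) * eval Q x  ≈⟨ +-cong (roots zero) (*-congˡ (Q-zero x)) ⟩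
    0# + (x - b₀) * 0#                      ≈⟨ trans (+-identityˡ _) (zeroʳ _) ⟩
    0#                                      ∎
    where
    b₀ = b zero
    Q = divide b₀ (c ∷ cs)
    -- The quotient vanishes at the remaining n points, as x - b₀ does not.
    Q-roots : ∀ i → eval Q (b (suc i)) ≈ 0#
    Q-roots i = nonzero-cancel distinct (begin
      (bᵢ - b₀) * eval Q bᵢ                      ≈⟨ sym (+-identityˡ _) ⟩
      0# + (bᵢ - b₀) * eval Q bᵢ                 ≈⟨ +-congʳ (sym (roots zero)) ⟩
      eval (c ∷ cs) b₀ + (bᵢ - b₀) * eval Q bᵢ   ≈⟨ sym (remainder-theorem b₀ (c ∷ cs) bᵢ) ⟩
      eval (c ∷ cs) bᵢ                           ≈⟨ roots (suc i) ⟩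
      0#                                         ∎)
      where
      bᵢ = b (suc i)
      distinct : ¬ (bᵢ - b₀ ≈ 0#)
      distinct e with b-inj (suc i) zero (+G.x∙y⁻¹≈ε⇒x≈y bᵢ b₀ e)
      ... | ()
    Q-zero : ∀ y → eval Q y ≈ 0#
    Q-zero = root-bound n Q (P.trans (divide-length b₀ c cs) (ℕP.suc-injective len))
               (λ i → b (suc i)) (λ i j e → FinP.suc-injective (b-inj (suc i) (suc j) e)) Q-roots

  monomial : ℕ → List Carrier
  monomial ℕ.zero    = 1# ∷ []
  monomial (ℕ.suc k) = 0# ∷ monomial k

  monomial-length : ∀ k → length (monomial k) ≡ ℕ.suc k
  monomial-length ℕ.zero    = P.refl
  monomial-length (ℕ.suc k) = P.cong ℕ.suc (monomial-length k)

  eval-monomial : ∀ k x → eval (monomial k) x ≈ x ^ k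
  eval-monomial ℕ.zero    x = trans (+-congˡ (zeroʳ x)) (+-identityʳ 1#)
  eval-monomial (ℕ.suc k) x = trans (+-identityˡ _) (*-congˡ (eval-monomial k x))

  power-minus-one : ℕ → List Carrier
  power-minus-one k = - 1# ∷ monomial k

  eval-power-minus-one : ∀ k x → eval (power-minus-one k) x ≈ - 1# + x ^ ℕ.suc k
  eval-power-minus-one k x = +-congˡ (*-congˡ (eval-monomial k x))

  -- Power sums over a finite field with q + 1 elements, enumerated without
  -- repetition by a, starting with a 0 = 0.

  module PowerSums {q : ℕ} (a : Fin (ℕ.suc q) → Carrier)
                   (a-injective : ∀ i j → a i ≈ a j → i ≡ j)
                   (a-surjective : ∀ x → ∃ λ i → a i ≈ x)
                   (a₀≈0 : a zero ≈ 0#) where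

    index : Carrier → Fin (ℕ.suc q)
    index x = proj₁ (a-surjective x)

    a-index : ∀ x → a (index x) ≈ x
    a-index x = proj₂ (a-surjective x)

    _≈?_ : ∀ x y → Dec (x ≈ y)
    x ≈? y with index x Fin.≟ index y
    ... | yes i≡j = yes (trans (sym (a-index x)) (trans (reflexive (P.cong a i≡j)) (a-index y)))
    ... | no  i≢j = no (λ x≈y → i≢j (a-injective _ _
                          (trans (a-index x) (trans x≈y (sym (a-index y))))))

    sum-reindex : (g h : Carrier → Carrier) →
                  (∀ {x y} → x ≈ y → g x ≈ g y) → (∀ {x y} → x ≈ y → h x ≈ h y) →
                  (∀ x → g (h x) ≈ x) → (∀ x → h (g x) ≈ x) →
                  (f : Carrier → Carrier) → (∀ {x y} → x ≈ y → f x ≈ f y) →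
                  sum (λ k → f (a k)) ≈ sum (λ k → f (g (a k)))
    sum-reindex g h g-cong h-cong gh hg f f-cong = begin
      sum (λ k → f (a k))      ≈⟨ ∑-permute (λ k → f (a k)) (permutation π ρ πρ ρπ) ⟩
      sum (λ k → f (a (π k)))  ≈⟨ sum-cong-≋ (λ k → f-cong (a-index (g (a k)))) ⟩
      sum (λ k → f (g (a k)))  ∎
      where
      π ρ : Fin (ℕ.suc q) → Fin (ℕ.suc q)
      π k = index (g (a k))
      ρ k = index (h (a k))
      πρ : ∀ k → π (ρ k) ≡ k
      πρ k = a-injective _ _ (trans (a-index _) (trans (g-cong (a-index _)) (gh (a k))))
      ρπ : ∀ k → ρ (π k) ≡ k
      ρπ k = a-injective _ _ (trans (a-index _) (trans (h-cong (a-index _)) (hg (a k))))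

    -- q · 1 = 0: translating by 1 permutes the field.
    sum-ones : sum {ℕ.suc q} (λ _ → 1#) ≈ 0#
    sum-ones = +G.identityʳ-unique (sum a) (sum {ℕ.suc q} (λ _ → 1#)) (sym (begin
      sum a                            ≈⟨ sum-reindex (_+ 1#) (_- 1#) +-congʳ +-congʳ
                                            (+G.//-rightDividesˡ 1#) (+G.//-rightDividesʳ 1#) (λ x → x) (λ e → e) ⟩
      sum (λ k → a k + 1#)             ≈⟨ ∑-distrib-+ a (λ _ → 1#) ⟩
      sum a + sum {ℕ.suc q} (λ _ → 1#) ∎))

    power-sum : ℕ → Carrier
    power-sum m = sum (λ k → a k ^ m)

    -- Multiplying every element by c ≠ 0 permutes the field, so c^m fixes
    -- the m-th power sum.
    power-sum-scale : ∀ m c → ¬ (c ≈ 0#) → c ^ m * power-sum m ≈ power-sum m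
    power-sum-scale m c c≉0 with inverse c c≉0
    ... | c⁻¹ , cc⁻¹≈1 = begin
      c ^ m * power-sum m          ≈⟨ *-distribˡ-sum (c ^ m) (λ k → a k ^ m) ⟩
      sum (λ k → c ^ m * a k ^ m)  ≈⟨ sum-cong-≋ (λ k → sym (^-distrib-* c (a k) m)) ⟩
      sum (λ k → (c * a k) ^ m)    ≈⟨ sym (sum-reindex (c *_) (c⁻¹ *_) *-congˡ *-congˡ
                                         (inverse-cancel (trans (*-comm c⁻¹ c) cc⁻¹≈1))
                                         (inverse-cancel cc⁻¹≈1) (_^ m) (^-congˡ m)) ⟩
      power-sum m                  ∎

    power-sum-unit : ∀ m → ¬ (power-sum m ≈ 0#) → ∀ c → ¬ (c ≈ 0#) → c ^ m ≈ 1#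
    power-sum-unit m S≉0 c c≉0 = +G.x∙y⁻¹≈ε⇒x≈y (c ^ m) 1# (nonzero-cancel S≉0 (begin
      S * (c ^ m - 1#)    ≈⟨ x[y-z]≈xy-xz S (c ^ m) 1# ⟩
      S * c ^ m - S * 1#  ≈⟨ +-cong (trans (*-comm S (c ^ m)) (power-sum-scale m c c≉0)) (-‿cong (*-identityʳ S)) ⟩
      S - S               ≈⟨ -‿inverseʳ S ⟩
      0#                  ∎))
      where S = power-sum m

    power-sum-vanishes : ∀ m → ℕ.suc m ℕ.≤ q → power-sum m ≈ 0#
    power-sum-vanishes ℕ.zero    _  = sum-ones
    power-sum-vanishes (ℕ.suc k) le with power-sum (ℕ.suc k) ≈? 0#
    ... | yes S≈0 = S≈0
    ... | no  S≉0 = ⊥-elim (1≉0 (begin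
      1#        ≈⟨ sym (+G.⁻¹-involutive 1#) ⟩
      - (- 1#)  ≈⟨ -‿cong -1≈0 ⟩
      - 0#      ≈⟨ +G.ε⁻¹≈ε ⟩
      0#        ∎))
      where
      -- k + 2 distinct nonzero roots of x^(k+1) - 1.
      b : Fin (ℕ.suc (ℕ.suc k)) → Carrier
      b i = a (suc (inject≤ i le))
      b-injective : ∀ i j → b i ≈ b j → i ≡ j
      b-injective i j e = FinP.inject≤-injective le le i j (FinP.suc-injective (a-injective _ _ e))
      b-nonzero : ∀ i → ¬ (b i ≈ 0#)
      b-nonzero i e with a-injective _ _ (trans e (sym a₀≈0))
      ... | ()
      b-roots : ∀ i → eval (power-minus-one k) (b i) ≈ 0#
      b-roots i = trans (eval-power-minus-one k (b i))
                    (trans (+-congˡ (power-sum-unit (ℕ.suc k) S≉0 (b i) (b-nonzero i))) (-‿inverseˡ 1#))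
      -1≈0 : - 1# ≈ 0#
      -1≈0 = begin
        - 1#                                ≈⟨ sym (trans (+-congˡ (zeroˡ _)) (+-identityʳ _)) ⟩
        - 1# + 0# ^ ℕ.suc k                 ≈⟨ sym (eval-power-minus-one k 0#) ⟩
        eval (power-minus-one k) 0#         ≈⟨ root-bound _ (power-minus-one k) (P.cong ℕ.suc (monomial-length k))
                                                 b b-injective b-roots 0# ⟩
        0#                                  ∎

  module Cipher {n : ℕ} (u : Fin n → Carrier) (r : Carrier) where

    W : Fin n → Fin n → Carrier
    W i j = (u j - u i) + r * I i j

    -- The two linear functionals through which A acts.
    S Pᵤ : (Fin n → Carrier) → Carrier
    S  v = sum v
    Pᵤ v = sum (λ k → u k * v k)

    entry-times : ∀ x y δ w → ((x - y) + r * δ) * w ≈ (x * w - y * w) + r * (δ * w)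
    entry-times x y δ w = trans (distribʳ w _ _) (+-cong ([y-z]x≈yx-zx w x y) (*-assoc r δ w))

    W-apply : ∀ v j → (W ⊛ v) j ≈ (Pᵤ v - u j * S v) + r * v j
    W-apply v j = begin
      (W ⊛ v) j                                                     ≡⟨ ⊛-sum W v j ⟩
      sum (λ k → W j k * v k)                                       ≈⟨ sum-cong-≋ (λ k → entry-times (u k) (u j) (I j k) (v k)) ⟩
      sum (λ k → (u k * v k - u j * v k) + r * (I j k * v k))       ≈⟨ sum-shape r (λ k → u k * v k) (λ k → u j * v k) (λ k → I j k * v k) ⟩
      (Pᵤ v - sum (λ k → u j * v k)) + r * sum (λ k → I j k * v k)  ≈⟨ +-cong (+-congˡ (-‿cong (sym (*-distribˡ-sum (u j) v))))
                                                                               (*-congˡ (sum-I j v)) ⟩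
      (Pᵤ v - u j * S v) + r * v j                                  ∎

    Wᵀ-apply : ∀ v i → ((W ᵀ) ⊛ v) i ≈ (u i * S v - Pᵤ v) + r * v i
    Wᵀ-apply v i = begin
      ((W ᵀ) ⊛ v) i                                                 ≡⟨ ⊛-sum (W ᵀ) v i ⟩
      sum (λ j → W j i * v j)                                       ≈⟨ sum-cong-≋ (λ j → entry-times (u i) (u j) (I j i) (v j)) ⟩
      sum (λ j → (u i * v j - u j * v j) + r * (I j i * v j))       ≈⟨ sum-shape r (λ j → u i * v j) (λ j → u j * v j) (λ j → I j i * v j) ⟩
      (sum (λ j → u i * v j) - Pᵤ v) + r * sum (λ j → I j i * v j)  ≈⟨ +-cong (+-congʳ (sym (*-distribˡ-sum (u i) v)))
                                                                               (*-congˡ (sum-Iᵀ i v)) ⟩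
      (u i * S v - Pᵤ v) + r * v i                                  ∎

    drop-zeros : ∀ {x y} z → x ≈ 0# → y ≈ 0# → (x - y) + z ≈ z
    drop-zeros z x≈0 y≈0 = trans (+-congʳ (trans (+-cong x≈0 (trans (-‿cong y≈0) +G.ε⁻¹≈ε)) (+-identityˡ 0#)))
                                 (+-identityˡ z)

    module Orthogonal (sum-ones : sum {n} (λ _ → 1#) ≈ 0#) (sum-u : sum u ≈ 0#)
                      (sum-u² : sum (λ k → u k * u k) ≈ 0#) where

      S-W : ∀ v → S (W ⊛ v) ≈ r * S v
      S-W v = begin
        sum (W ⊛ v)                                               ≈⟨ sum-cong-≋ (W-apply v) ⟩
        sum (λ j → (Pᵤ v - u j * S v) + r * v j)                  ≈⟨ sum-shape r _ _ v ⟩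
        (sum {n} (λ _ → Pᵤ v) - sum (λ j → u j * S v)) + r * S v  ≈⟨ drop-zeros (r * S v) constant-sum (sum-*ʳ-zero u (S v) sum-u) ⟩
        r * S v                                                   ∎
        where
        constant-sum : sum {n} (λ _ → Pᵤ v) ≈ 0#
        constant-sum = trans (sum-cong-≋ {n} (λ _ → sym (*-identityˡ (Pᵤ v)))) (sum-*ʳ-zero {n} (λ _ → 1#) (Pᵤ v) sum-ones)

      P-W : ∀ v → Pᵤ (W ⊛ v) ≈ r * Pᵤ v
      P-W v = begin
        sum (λ j → u j * (W ⊛ v) j)                                         ≈⟨ sum-cong-≋ (λ j → trans (*-congˡ (W-apply v j)) (expand (u j) (v j))) ⟩
        sum (λ j → (u j * Pᵤ v - (u j * u j) * S v) + r * (u j * v j))       ≈⟨ sum-shape r (λ j → u j * Pᵤ v) (λ j → (u j * u j) * S v) (λ j → u j * v j) ⟩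
        (sum (λ j → u j * Pᵤ v) - sum (λ j → (u j * u j) * S v)) + r * Pᵤ v  ≈⟨ drop-zeros (r * Pᵤ v) (sum-*ʳ-zero u (Pᵤ v) sum-u)
                                                                                  (sum-*ʳ-zero (λ j → u j * u j) (S v) sum-u²) ⟩
        r * Pᵤ v                                                             ∎
        where
        expand : ∀ y m → y * ((Pᵤ v - y * S v) + r * m) ≈ (y * Pᵤ v - (y * y) * S v) + r * (y * m)
        expand y m = trans (distribˡ y _ _)
                           (+-cong (trans (x[y-z]≈xy-xz y (Pᵤ v) _) (+-congˡ (-‿cong (sym (*-assoc y y (S v))))))
                                   (*S.x∙yz≈y∙xz y r m))

      cancellation : ∀ y s p m → (y * (r * s) - r * p) + r * ((p - y * s) + r * m) ≈ (r * r) * m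
      cancellation y s p m = begin
        (A - B) + r * ((p - y * s) + r * m)  ≈⟨ +-congˡ (trans (distribˡ r _ _)
                                                  (+-cong (trans (x[y-z]≈xy-xz r p (y * s)) (+-congˡ (-‿cong (*S.x∙yz≈y∙xz r y s))))
                                                          (sym (*-assoc r r m)))) ⟩
        (A - B) + ((B - A) + C)              ≈⟨ +-congˡ (+-congʳ (sym (+G.⁻¹-anti-homo‿- A B))) ⟩
        (A - B) + (- (A - B) + C)            ≈⟨ sym (+-assoc _ _ C) ⟩
        ((A - B) - (A - B)) + C              ≈⟨ +-congʳ (-‿inverseʳ (A - B)) ⟩
        0# + C                               ≈⟨ +-identityˡ C ⟩
        C                                    ∎
        where
        A = y * (r * s)
        B = r * p
        C = (r * r) * m

      WᵀW : ∀ v i → ((W ᵀ) ⊛ (W ⊛ v)) i ≈ (r * r) * v i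
      WᵀW v i = begin
        ((W ᵀ) ⊛ (W ⊛ v)) i                                                ≈⟨ Wᵀ-apply (W ⊛ v) i ⟩
        (u i * S (W ⊛ v) - Pᵤ (W ⊛ v)) + r * (W ⊛ v) i                     ≈⟨ +-cong (+-cong (*-congˡ (S-W v)) (-‿cong (P-W v)))
                                                                                     (*-congˡ (W-apply v i)) ⟩
        (u i * (r * S v) - r * Pᵤ v) + r * ((Pᵤ v - u i * S v) + r * v i)  ≈⟨ cancellation (u i) (S v) (Pᵤ v) (v i) ⟩
        (r * r) * v i                                                      ∎

theorem6 : ∀ {c ℓ : Level} (F : Field c ℓ) (p α q : ℕ) →
    Prime p → 1 ℕ.≤ α → q ≡ p ℕ.^ α →
    let open Field F in
    let open FieldOps F in
    (a : Fin q → Carrier) →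
    (∀ i j → a i ≈ a j → i ≡ j) →
    (∀ x → ∃ λ i → a i ≈ x) →
    (∀ i → toℕ i ≡ 0 → a i ≈ 0#) →
    (t : ℕ) → 1 ℕ.≤ t → 2 ℕ.* t ℕ.< q ℕ.∸ 1 →
    (r : Carrier) → ¬ (r ≈ 0#) →
    (M : Fin q → Carrier) →
    (∃ λ l → ((r * r) * l ≈ 1#) × (∀ l′ → (r * r) * l′ ≈ 1# → l′ ≈ l))
    × (∀ l → (r * r) * l ≈ 1# →
    ∀ i → (l · ((Wmat a t r ᵀ) ⊛ (Wmat a t r ⊛ M))) i ≈ M i)
theorem6 _ _ _ ℕ.zero    _ _ _ _ _ _ _ _ _ () _ _ _
theorem6 F _ _ (ℕ.suc q) _ _ _ a a-injective a-surjective a-zero t _ 2t<q r r≉0 M =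
    (l , rrl≈1 , λ l′ rrl′≈1 → inverse-unique rrl≈1 rrl′≈1)
  , λ l′ rrl′≈1 i → trans (*-congˡ (WᵀW M i)) (inverse-cancel rrl′≈1 (M i))
  where
  open Field F hiding (zero)
  open FieldOps F using () renaming (_^_ to _^ᶠ_)
  open FieldTheory F
  open SemiringSum semiring using (sum; sum-cong-≋)
  open SemiringExp semiring using (^-homo-*)
  open PowerSums a a-injective a-surjective (a-zero zero P.refl)

  rr≉0 : ¬ (r * r ≈ 0#)
  rr≉0 rr≈0 = r≉0 (nonzero-cancel r≉0 rr≈0)

  l : Carrier
  l = proj₁ (inverse (r * r) rr≉0)

  rrl≈1 : (r * r) * l ≈ 1#
  rrl≈1 = proj₂ (inverse (r * r) rr≉0)

  u : Fin (ℕ.suc q) → Carrier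
  u k = a k ^ᶠ t

  -- The power sums of exponents t and 2t vanish, as 2t < q - 1.
  sum-u : sum u ≈ 0#
  sum-u = trans (sum-cong-≋ (λ k → reflexive (^-agrees (a k) t)))
                (power-sum-vanishes t (ℕP.≤-trans (ℕ.s≤s (ℕP.m≤m+n t _)) 2t<q))

  sum-u² : sum (λ k → u k * u k) ≈ 0#
  sum-u² = trans (sum-cong-≋ (λ k → trans (reflexive (P.cong₂ _*_ (^-agrees (a k) t) (^-agrees (a k) t)))
                                            (sym (^-homo-* (a k) t t))))
                 (power-sum-vanishes (t ℕ.+ t) (P.subst (λ z → ℕ.suc (t ℕ.+ z) ℕ.≤ q) (ℕP.+-identityʳ t) 2t<q))

  open Cipher u r
  open Orthogonal sum-ones sum-u sum-u²
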